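{- For every Boolean function $f:\{0,1\}^n\to\{0,1\}$, $$\mathrm{K}(f)\le \max_{J\text{ subcube}}\mathrm{K}(f|_J)\le \mathrm{Rank}(f).$$
   Context: A subcube $J=(S,\rho)$ is given by a set $S\subseteq[n]$ and an assignment $\rho:S\to\{0,1\}$; its co-dimension is $|S|$, and $f|_J$ is the function on the remaining variables obtained by fixing the variables in $S$ according to $\rho$. The subcube kill number $\mathrm{K}(f)$ is the minimum co-dimension of a subcube $J$ on which $f|_J$ is constant. A decision tree queries single variables and has $0/1$ leaves. Rank of a rooted binary tree: leaves have rank $0$; an internal node with children of ranks $a,b$ has rank $a+1$ if $a=b$, else $\max\{a,b\}$; $\mathrm{Rank}(f)$ is the minimum rank of a decision tree computing $f$. -}

module Defs where

open import Data.Nat using (ℕ; zero; suc; _≤_; _⊔_; _≡ᵇ_)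
open import Data.Bool using (Bool; true; false; if_then_else_)
open import Data.Maybe using (Maybe; just; nothing)
open import Data.Fin using (Fin)
open import Data.Vec using (Vec; []; _∷_; lookup)
open import Data.Product using (Σ; _×_; ∃)
open import Relation.Binary.PropositionalEquality using (_≡_)

BF : ℕ → Set
BF n = Vec Bool n → Bool

-- A subcube J = (S, ρ): position i is 'just b' if i ∈ S with ρ(i) = b,
-- and 'nothing' if i is a free (unfixed) variable.
Subcube : ℕ → Set
Subcube n = Vec (Maybe Bool) n

codim : ∀ {n} → Subcube n → ℕ
codim [] = zero
codim (nothing ∷ ρ) = codim ρ
codim (just _ ∷ ρ) = suc (codim ρ)

free : ∀ {n} → Subcube n → ℕ
free [] = zero
free (nothing ∷ ρ) = suc (free ρ)
free (just _ ∷ ρ) = free ρ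

restrict : ∀ {n} (ρ : Subcube n) → BF n → BF (free ρ)
restrict [] f xs = f xs
restrict (nothing ∷ ρ) f (b ∷ xs) = restrict ρ (λ ys → f (b ∷ ys)) xs
restrict (just b ∷ ρ) f xs = restrict ρ (λ ys → f (b ∷ ys)) xs

Constant : ∀ {m} → BF m → Set
Constant g = ∃ λ c → ∀ x → g x ≡ c

IsMin : (ℕ → Set) → ℕ → Set
IsMin P k = P k × (∀ j → P j → k ≤ j)

IsMax : (ℕ → Set) → ℕ → Set
IsMax P k = P k × (∀ j → P j → j ≤ k)

IsK : ∀ {n} → BF n → ℕ → Set
IsK {n} f = IsMin (λ c → Σ (Subcube n) λ ρ → codim ρ ≡ c × Constant (restrict ρ f))

IsMaxKRestr : ∀ {n} → BF n → ℕ → Set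
IsMaxKRestr {n} f = IsMax (λ v → Σ (Subcube n) λ ρ → IsK (restrict ρ f) v)

data DT (n : ℕ) : Set where
  leaf  : Bool → DT n
  query : Fin n → DT n → DT n → DT n

eval : ∀ {n} → DT n → Vec Bool n → Bool
eval (leaf b) x = b
eval (query i t₀ t₁) x = if lookup x i then eval t₁ x else eval t₀ x

Computes : ∀ {n} → DT n → BF n → Set
Computes T f = ∀ x → eval T x ≡ f x

rankNode : ℕ → ℕ → ℕ
rankNode a b = if a ≡ᵇ b then suc a else a ⊔ b

rank : ∀ {n} → DT n → ℕ
rank (leaf _) = zero
rank (query i t₀ t₁) = rankNode (rank t₀) (rank t₁)

IsRank : ∀ {n} → BF n → ℕ → Set
IsRank {n} f = IsMin (λ c → Σ (DT n) λ T → Computes T f × rank T ≡ c)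

{-# OPTIONS --safe #-}
-- Taking J to be the whole cube gives K(f) = K(f|_J) ≤ max_J K(f|_J). For the second inequality
-- fix J and a decision tree of rank r computing f, and walk down from the root: at a variable
-- fixed by J follow J, otherwise fix the variable so as to enter a child of strictly smaller
-- rank, which the definition of rank guarantees. Every newly fixed variable thus costs a unit
-- of rank, so a leaf is reached inside a subcube of J cut out by at most r further variables,
-- and f is constant there.
module Submission where

open import Data.Bool using (Bool; true; false; if_then_else_; T)
open import Data.Bool.Properties using (if-float)
open import Data.Fin using (Fin) renaming (zero to fzero; suc to fsuc)
open import Data.Maybe using (just; nothing)
open import Data.Maybe.Relation.Unary.All using (just; nothing; drop-just)
  renaming (All to AllMaybe)
open import Data.Nat using (ℕ; zero; suc; _+_; _≤_; _<_; _≡ᵇ_)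
open import Data.Nat.Properties
open import Data.Product using (Σ; _×_; ∃; ∃-syntax; _,_; proj₁; proj₂)
open import Data.Sum using (_⊎_; inj₁; inj₂)
open import Data.Unit using (tt)
open import Data.Vec using (Vec; []; _∷_; lookup; _[_]≔_)
open import Data.Vec.Properties using (lookup∘updateAt)
open import Data.Vec.Relation.Binary.Pointwise.Inductive as Pointwise
  using (Pointwise; []; _∷_)
open import Function using (_⇔_; mk⇔; Equivalence)
open import Relation.Binary using (tri<; tri≈; tri>)
open import Relation.Binary.PropositionalEquality
open import Relation.Nullary using (contradiction)

open import Defs

private
  variable
    n p q : ℕ

_∈ᶜ_ : Vec Bool n → Subcube n → Set
x ∈ᶜ τ = Pointwise (λ s b → AllMaybe (_≡ b) s) τ x

∈ᶜ-lookup : ∀ {x : Vec Bool n} {τ} → x ∈ᶜ τ → ∀ i {b} → lookup τ i ≡ just b → lookup x i ≡ b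
∈ᶜ-lookup x∈τ i τᵢ≡b = sym (drop-just (subst (AllMaybe _) τᵢ≡b (Pointwise.lookup x∈τ i)))

ConstantOn : Subcube n → BF n → Set
ConstantOn τ g = ∃ λ c → ∀ x → x ∈ᶜ τ → g x ≡ c

infix 4 _⊆ᶜ_

data _⊆ᶜ_ : Subcube n → Subcube n → Set where
  []      : [] ⊆ᶜ []
  atFree  : ∀ s {σ τ : Subcube n} → σ ⊆ᶜ τ → s ∷ σ ⊆ᶜ nothing ∷ τ
  atFixed : ∀ b {σ τ : Subcube n} → σ ⊆ᶜ τ → just b ∷ σ ⊆ᶜ just b ∷ τ

⊆ᶜ-refl : (τ : Subcube n) → τ ⊆ᶜ τ
⊆ᶜ-refl []            = []
⊆ᶜ-refl (nothing ∷ τ) = atFree nothing (⊆ᶜ-refl τ)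
⊆ᶜ-refl (just b ∷ τ)  = atFixed b (⊆ᶜ-refl τ)

⊆ᶜ-trans : {ρ σ τ : Subcube n} → ρ ⊆ᶜ σ → σ ⊆ᶜ τ → ρ ⊆ᶜ τ
⊆ᶜ-trans []              []              = []
⊆ᶜ-trans (atFree s ρ⊆σ)  (atFree _ σ⊆τ)  = atFree s (⊆ᶜ-trans ρ⊆σ σ⊆τ)
⊆ᶜ-trans (atFixed b ρ⊆σ) (atFree _ σ⊆τ)  = atFree (just b) (⊆ᶜ-trans ρ⊆σ σ⊆τ)
⊆ᶜ-trans (atFixed b ρ⊆σ) (atFixed _ σ⊆τ) = atFixed b (⊆ᶜ-trans ρ⊆σ σ⊆τ)

⊆ᶜ-points : {σ τ : Subcube n} → σ ⊆ᶜ τ → ∀ {x} → x ∈ᶜ σ → x ∈ᶜ τ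
⊆ᶜ-points []              []            = []
⊆ᶜ-points (atFree _ σ⊆τ)  (_ ∷ x∈σ)     = nothing ∷ ⊆ᶜ-points σ⊆τ x∈σ
⊆ᶜ-points (atFixed _ σ⊆τ) (xᵢ≡b ∷ x∈σ) = xᵢ≡b ∷ ⊆ᶜ-points σ⊆τ x∈σ

fix-⊆ᶜ : (τ : Subcube n) (i : Fin n) (b : Bool) → lookup τ i ≡ nothing → τ [ i ]≔ just b ⊆ᶜ τ
fix-⊆ᶜ (nothing ∷ τ) fzero    b _       = atFree (just b) (⊆ᶜ-refl τ)
fix-⊆ᶜ (nothing ∷ τ) (fsuc i) b τᵢ-free   = atFree nothing (fix-⊆ᶜ τ i b τᵢ-free)
fix-⊆ᶜ (just c ∷ τ)  (fsuc i) b τᵢ-free   = atFixed c (fix-⊆ᶜ τ i b τᵢ-free)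

codim-fix : (τ : Subcube n) (i : Fin n) (b : Bool) →
            lookup τ i ≡ nothing → codim (τ [ i ]≔ just b) ≡ suc (codim τ)
codim-fix (nothing ∷ τ) fzero    b _       = refl
codim-fix (nothing ∷ τ) (fsuc i) b τᵢ-free = codim-fix τ i b τᵢ-free
codim-fix (just c ∷ τ)  (fsuc i) b τᵢ-free = cong suc (codim-fix τ i b τᵢ-free)

fill : (τ : Subcube n) → Vec Bool (free τ) → Vec Bool n
fill []            y       = y
fill (nothing ∷ τ) (b ∷ y) = b ∷ fill τ y
fill (just b ∷ τ)  y       = b ∷ fill τ y

fill-∈ᶜ : (τ : Subcube n) (y : Vec Bool (free τ)) → fill τ y ∈ᶜ τ
fill-∈ᶜ []            []      = []
fill-∈ᶜ (nothing ∷ τ) (_ ∷ y) = nothing ∷ fill-∈ᶜ τ y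
fill-∈ᶜ (just _ ∷ τ)  y       = just refl ∷ fill-∈ᶜ τ y

restrict-fill : (τ : Subcube n) (f : BF n) (y : Vec Bool (free τ)) → restrict τ f y ≡ f (fill τ y)
restrict-fill []            f []      = refl
restrict-fill (nothing ∷ τ) f (b ∷ y) = restrict-fill τ (λ ys → f (b ∷ ys)) y
restrict-fill (just b ∷ τ)  f y       = restrict-fill τ (λ ys → f (b ∷ ys)) y

constantOn⇒constant-restrict : (τ : Subcube n) {f : BF n} → ConstantOn τ f → Constant (restrict τ f)
constantOn⇒constant-restrict τ {f} (c , f≡c) =
  c , λ y → trans (restrict-fill τ f y) (f≡c (fill τ y) (fill-∈ᶜ τ y))

within : (ρ : Subcube n) → Subcube (free ρ) → Subcube n
within []            σ       = σ
within (nothing ∷ ρ) (s ∷ σ) = s ∷ within ρ σ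
within (just b ∷ ρ)  σ       = just b ∷ within ρ σ

codim-within : (ρ : Subcube n) (σ : Subcube (free ρ)) → codim (within ρ σ) ≡ codim ρ + codim σ
codim-within []            σ             = refl
codim-within (nothing ∷ ρ) (nothing ∷ σ) = codim-within ρ σ
codim-within (nothing ∷ ρ) (just _ ∷ σ)  =
  trans (cong suc (codim-within ρ σ)) (sym (+-suc (codim ρ) (codim σ)))
codim-within (just _ ∷ ρ)  σ             = cong suc (codim-within ρ σ)

⊆ᶜ⇒within : {τ ρ : Subcube n} → τ ⊆ᶜ ρ → ∃[ σ ] within ρ σ ≡ τ
⊆ᶜ⇒within []            = [] , refl
⊆ᶜ⇒within (atFree s τ⊆ρ) with ⊆ᶜ⇒within τ⊆ρ
... | σ , refl = s ∷ σ , refl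
⊆ᶜ⇒within (atFixed b τ⊆ρ) with ⊆ᶜ⇒within τ⊆ρ
... | σ , refl = σ , refl

infix 4 _⊑_

_⊑_ : BF p → BF q → Set
g ⊑ h = ∀ x → ∃ λ y → g x ≡ h y

⊑-constant : {g : BF p} {h : BF q} → g ⊑ h → Constant h → Constant g
⊑-constant g⊑h (c , h≡c) = c , λ x → let y , gx≡hy = g⊑h x in trans gx≡hy (h≡c y)

SameValues : BF p → BF q → Set
SameValues g h = g ⊑ h × h ⊑ g

-- The domains Vec Bool (free σ) and Vec Bool (free (within ρ σ)) agree only propositionally,
-- so the two restrictions are compared through their sets of values.
restrict-restrict≈restrict-within : (ρ : Subcube n) (σ : Subcube (free ρ)) (f : BF n) →
                                    SameValues (restrict σ (restrict ρ f)) (restrict (within ρ σ) f)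
restrict-restrict≈restrict-within []            σ             f = (λ x → x , refl) , (λ x → x , refl)
restrict-restrict≈restrict-within (nothing ∷ ρ) (nothing ∷ σ) f =
  (λ { (b ∷ x) → let y , eq = proj₁ (fixFirst b) x in b ∷ y , eq }) ,
  (λ { (b ∷ x) → let y , eq = proj₂ (fixFirst b) x in b ∷ y , eq })
  where
  fixFirst : ∀ b → SameValues (restrict σ (restrict ρ (λ ys → f (b ∷ ys))))
                              (restrict (within ρ σ) (λ ys → f (b ∷ ys)))
  fixFirst b = restrict-restrict≈restrict-within ρ σ (λ ys → f (b ∷ ys))
restrict-restrict≈restrict-within (nothing ∷ ρ) (just b ∷ σ)  f =
  restrict-restrict≈restrict-within ρ σ (λ ys → f (b ∷ ys))
restrict-restrict≈restrict-within (just b ∷ ρ)  σ             f =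
  restrict-restrict≈restrict-within ρ σ (λ ys → f (b ∷ ys))

constant-restrict-restrict⇔ : (ρ : Subcube n) (σ : Subcube (free ρ)) (f : BF n) →
                              Constant (restrict σ (restrict ρ f)) ⇔ Constant (restrict (within ρ σ) f)
constant-restrict-restrict⇔ ρ σ f = let g⊑h , h⊑g = restrict-restrict≈restrict-within ρ σ f in
  mk⇔ (⊑-constant h⊑g) (⊑-constant g⊑h)

whole : ∀ n → Subcube n
whole zero    = []
whole (suc n) = nothing ∷ whole n

⊆ᶜ-whole : (τ : Subcube n) → τ ⊆ᶜ whole n
⊆ᶜ-whole []      = []
⊆ᶜ-whole (s ∷ τ) = atFree s (⊆ᶜ-whole τ)

codim-within-whole : ∀ n (σ : Subcube (free (whole n))) → codim (within (whole n) σ) ≡ codim σ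
codim-within-whole zero    σ             = refl
codim-within-whole (suc n) (nothing ∷ σ) = codim-within-whole n σ
codim-within-whole (suc n) (just _ ∷ σ)  = cong suc (codim-within-whole n σ)

≤-rankNodeˡ : ∀ a b → a ≤ rankNode a b
≤-rankNodeˡ a b with a ≡ᵇ b
... | true  = n≤1+n a
... | false = m≤m⊔n a b

≤-rankNodeʳ : ∀ a b → b ≤ rankNode a b
≤-rankNodeʳ a b with a ≡ᵇ b in a≡ᵇb
... | true  = ≤-trans (≤-reflexive (sym (≡ᵇ⇒≡ a b (subst T (sym a≡ᵇb) tt)))) (n≤1+n a)
... | false = m≤n⊔m a b

rankNode-drops : ∀ a b → a < rankNode a b ⊎ b < rankNode a b
rankNode-drops a b with a ≡ᵇ b in a≡ᵇb
... | true = inj₁ ≤-refl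
... | false with <-cmp a b
...   | tri< a<b _ _   = inj₁ (<-≤-trans a<b (m≤n⊔m a b))
...   | tri≈ _ a≡b _   = contradiction (subst T a≡ᵇb (≡⇒≡ᵇ a b a≡b)) λ ()
...   | tri> _ _ b<a   = inj₂ (<-≤-trans b<a (m≤m⊔n a b))

rank-branch≤ : ∀ b (t₀ t₁ : DT n) → rank (if b then t₁ else t₀) ≤ rankNode (rank t₀) (rank t₁)
rank-branch≤ false t₀ t₁ = ≤-rankNodeˡ (rank t₀) (rank t₁)
rank-branch≤ true  t₀ t₁ = ≤-rankNodeʳ (rank t₀) (rank t₁)

rank-branch< : (t₀ t₁ : DT n) → ∃[ b ] rank (if b then t₁ else t₀) < rankNode (rank t₀) (rank t₁)
rank-branch< t₀ t₁ with rankNode-drops (rank t₀) (rank t₁)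
... | inj₁ drop = false , drop
... | inj₂ drop = true  , drop

eval-query : ∀ i (t₀ t₁ : DT n) {x b} → lookup x i ≡ b →
             eval (query i t₀ t₁) x ≡ eval (if b then t₁ else t₀) x
eval-query i t₀ t₁ {x} refl = sym (if-float (λ t → eval t x) (lookup x i))

record KillingSubcube (g : BF n) (τ : Subcube n) (r : ℕ) : Set where
  constructor killingSubcube
  field
    cube     : Subcube n
    cube⊆τ   : cube ⊆ᶜ τ
    codim≤   : codim cube ≤ codim τ + r
    constant : ConstantOn cube g

killingSubcube-⊆ : {g h : BF n} {τ₁ τ : Subcube n} {r₁ r : ℕ} →
                   τ₁ ⊆ᶜ τ → codim τ₁ + r₁ ≤ codim τ + r → (∀ {x} → x ∈ᶜ τ₁ → h x ≡ g x) →
                   KillingSubcube g τ₁ r₁ → KillingSubcube h τ r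
killingSubcube-⊆ τ₁⊆τ bound h≡g (killingSubcube cube cube⊆τ₁ codim≤ (c , g≡c)) =
  killingSubcube cube (⊆ᶜ-trans cube⊆τ₁ τ₁⊆τ) (≤-trans codim≤ bound)
    (c , λ x x∈cube → trans (h≡g (⊆ᶜ-points cube⊆τ₁ x∈cube)) (g≡c x x∈cube))

killingSubcube-rank : (t : DT n) (τ : Subcube n) → KillingSubcube (eval t) τ (rank t)
killingSubcube-branch : ∀ b (t₀ t₁ : DT n) (τ : Subcube n) →
                        KillingSubcube (eval (if b then t₁ else t₀)) τ (rank (if b then t₁ else t₀))

killingSubcube-rank (leaf b) τ =
  killingSubcube τ (⊆ᶜ-refl τ) (m≤m+n (codim τ) 0) (b , λ _ _ → refl)
killingSubcube-rank {n} (query i t₀ t₁) τ with lookup τ i in τᵢ≡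
... | just b = killingSubcube-⊆ (⊆ᶜ-refl τ) (+-monoʳ-≤ (codim τ) (rank-branch≤ b t₀ t₁))
                 (λ x∈τ → eval-query i t₀ t₁ (∈ᶜ-lookup x∈τ i τᵢ≡))
                 (killingSubcube-branch b t₀ t₁ τ)
... | nothing with rank-branch< t₀ t₁
...   | b , drop = killingSubcube-⊆ (fix-⊆ᶜ τ i b τᵢ≡) bound
                     (λ x∈τ′ → eval-query i t₀ t₁ (∈ᶜ-lookup x∈τ′ i (lookup∘updateAt i τ)))
                     (killingSubcube-branch b t₀ t₁ τ′)
  where
  τ′ : Subcube n
  τ′ = τ [ i ]≔ just b
  tᵇ : DT n
  tᵇ = if b then t₁ else t₀
  bound : codim τ′ + rank tᵇ ≤ codim τ + rankNode (rank t₀) (rank t₁)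
  bound = begin
    codim τ′ + rank tᵇ       ≡⟨ cong (_+ rank tᵇ) (codim-fix τ i b τᵢ≡) ⟩
    suc (codim τ) + rank tᵇ  ≡⟨ +-suc (codim τ) (rank tᵇ) ⟨
    codim τ + suc (rank tᵇ)  ≤⟨ +-monoʳ-≤ (codim τ) drop ⟩
    codim τ + rankNode (rank t₀) (rank t₁) ∎
    where open ≤-Reasoning

killingSubcube-branch false t₀ t₁ τ = killingSubcube-rank t₀ τ
killingSubcube-branch true  t₀ t₁ τ = killingSubcube-rank t₁ τ

Kills : BF n → ℕ → Set
Kills {n} f c = Σ (Subcube n) λ τ → codim τ ≡ c × Constant (restrict τ f)

isMin-cong : {P Q : ℕ → Set} → (∀ c → P c ⇔ Q c) → ∀ {k} → IsMin P k → IsMin Q k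
isMin-cong P⇔Q (Pk , k-min) =
  Equivalence.to (P⇔Q _) Pk , λ j Qj → k-min j (Equivalence.from (P⇔Q j) Qj)

kills⇔kills-restrict-whole : (f : BF n) (c : ℕ) → Kills f c ⇔ Kills (restrict (whole n) f) c
kills⇔kills-restrict-whole {n} f c = mk⇔ to from
  where
  to : Kills f c → Kills (restrict (whole n) f) c
  to (τ , codimτ≡c , constant) with ⊆ᶜ⇒within (⊆ᶜ-whole τ)
  ... | σ , refl = σ , trans (sym (codim-within-whole n σ)) codimτ≡c ,
                   Equivalence.from (constant-restrict-restrict⇔ (whole n) σ f) constant
  from : Kills (restrict (whole n) f) c → Kills f c
  from (σ , codimσ≡c , constant) = within (whole n) σ , trans (codim-within-whole n σ) codimσ≡c ,
                                   Equivalence.to (constant-restrict-restrict⇔ (whole n) σ f) constant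

isK-restrict-whole : {f : BF n} {k : ℕ} → IsK f k → IsK (restrict (whole n) f) k
isK-restrict-whole {f = f} = isMin-cong (kills⇔kills-restrict-whole f)

kill-restrict≤rank : {f : BF n} (t : DT n) → Computes t f → (ρ : Subcube n) →
                     ∃[ σ ] codim σ ≤ rank t × Constant (restrict σ (restrict ρ f))
kill-restrict≤rank {f = f} t t≡f ρ with killingSubcube-rank t ρ
... | killingSubcube τ τ⊆ρ codimτ≤ (c , t≡c) with ⊆ᶜ⇒within τ⊆ρ
...   | σ , refl = σ , codimσ≤rank ,
                   Equivalence.from (constant-restrict-restrict⇔ ρ σ f)
                     (constantOn⇒constant-restrict (within ρ σ) f-constant)
  where
  codimσ≤rank : codim σ ≤ rank t
  codimσ≤rank = +-cancelˡ-≤ (codim ρ) (codim σ) (rank t)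
                  (subst (_≤ codim ρ + rank t) (codim-within ρ σ) codimτ≤)
  f-constant : ConstantOn (within ρ σ) f
  f-constant = c , λ x x∈τ → trans (sym (t≡f x)) (t≡c x x∈τ)

lemma5p1 : (n : ℕ) (f : BF n) (k m r : ℕ) →
    IsK f k → IsMaxKRestr f m → IsRank f r → k ≤ m × m ≤ r
lemma5p1 n f k m r isK ((ρ , (_ , m-min)) , m-max) ((t , t≡f , rank≡r) , _) = k≤m , m≤r
  where
  k≤m : k ≤ m
  k≤m = m-max k (whole n , isK-restrict-whole isK)
  m≤r : m ≤ r
  m≤r with kill-restrict≤rank {f = f} t t≡f ρ
  ... | σ , codimσ≤rank , constant =
    ≤-trans (m-min (codim σ) (σ , refl , constant)) (subst (codim σ ≤_) rank≡r codimσ≤rank)
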